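{- (i) For every prime $p$, the independent domination polynomial of the zero divisor graph $\Gamma(\mathbb{Z}_{p^{2}})$ is unimodal and log-concave. (ii) For every prime $p>2$, the independent domination polynomial of $\Gamma(\mathbb{Z}_{2p})$ is log-concave, and it is unimodal if and only if $p=3$.
   Context: For a commutative ring $R$ with identity, the zero divisor graph $\Gamma(R)$ is the simple graph whose vertices are the nonzero zero divisors of $R$ (nonzero $a$ with $ab=0$ for some nonzero $b$), two distinct vertices $a,b$ being adjacent iff $ab=0$. For a graph $G$, a set $S\subseteq V(G)$ is an independent dominating set if its vertices are pairwise non-adjacent and every vertex outside $S$ is adjacent to some vertex of $S$. Let $d_i(G,k)$ be the number of independent dominating sets of size $k$; the independent domination polynomial is $D_i(G,x)=\sum_{k} d_i(G,k)x^k$. A polynomial $\sum_{i=0}^{b}a_ix^i$ of degree $b$ is unimodal if there is an index $t$ with $a_0\le a_1\le\dots\le a_t\ge a_{t+1}\ge\dots\ge a_b$, and log-concave if $a_j^2\ge a_{j-1}a_{j+1}$ for all $1\le j\le b-1$. -}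

module Defs where

open import Data.Nat using (ℕ; zero; suc; _+_; _*_; _∸_; _^_; _≤_; _<_; _≟_; _<?_)
open import Data.Nat.Divisibility using (_∣_; _∣?_)
open import Data.List using (List; []; _∷_; map; _++_; filter; length; upTo)
open import Data.List.Relation.Unary.All using (All; all?)
open import Data.List.Relation.Unary.Any using (Any; any?)
open import Data.List.Relation.Unary.AllPairs using (AllPairs; allPairs?)
open import Data.List.Membership.Propositional using (_∈_)
open import Data.List.Membership.DecPropositional _≟_ using (_∈?_)
open import Data.Product using (_×_; ∃; ∃-syntax)
open import Data.Sum using (_⊎_)
open import Relation.Nullary using (¬_; Dec)
open import Relation.Nullary.Decidable using (_×-dec_; _⊎-dec_; ¬?)
open import Relation.Binary.PropositionalEquality using (_≡_; _≢_)

-- The ring Z_n is represented by the residues 0,1,...,n-1 (list 'upTo n');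
-- a * b = 0 in Z_n  iff  n ∣ a * b.

IsZeroDivisor : ℕ → ℕ → Set
IsZeroDivisor n a = (0 < a) × Any (λ b → (0 < b) × (n ∣ a * b)) (upTo n)

isZeroDivisor? : ∀ n a → Dec (IsZeroDivisor n a)
isZeroDivisor? n a = (0 <? a) ×-dec any? (λ b → (0 <? b) ×-dec (n ∣? a * b)) (upTo n)

vertices : ℕ → List ℕ
vertices n = filter (isZeroDivisor? n) (upTo n)

Adj : ℕ → ℕ → ℕ → Set
Adj n a b = (a ≢ b) × (n ∣ a * b)

adj? : ∀ n a b → Dec (Adj n a b)
adj? n a b = ¬? (a ≟ b) ×-dec (n ∣? a * b)

-- all subsets of a (duplicate-free) list, as sublists
sublists : {A : Set} → List A → List (List A)
sublists [] = [] ∷ []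
sublists (x ∷ xs) = map (x ∷_) (sublists xs) ++ sublists xs

Independent : ℕ → List ℕ → Set
Independent n S = AllPairs (λ a b → ¬ Adj n a b) S

Dominating : ℕ → List ℕ → Set
Dominating n S = All (λ v → (v ∈ S) ⊎ Any (Adj n v) S) (vertices n)

IsIDSofSize : ℕ → ℕ → List ℕ → Set
IsIDSofSize n k S = (length S ≡ k) × Independent n S × Dominating n S

isIDSofSize? : ∀ n k S → Dec (IsIDSofSize n k S)
isIDSofSize? n k S =
  (length S ≟ k) ×-dec
  (allPairs? (λ a b → ¬? (adj? n a b)) S ×-dec
   all? (λ v → (v ∈? S) ⊎-dec any? (adj? n v) S) (vertices n))

-- d_i(Γ(Z_n), k): coefficient of x^k in D_i(Γ(Z_n), x)
idCoeff : ℕ → ℕ → ℕ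
idCoeff n k = length (filter (isIDSofSize? n k) (sublists (vertices n)))

IsDegree : (ℕ → ℕ) → ℕ → Set
IsDegree a b = (a b ≢ 0) × (∀ k → b < k → a k ≡ 0)

Unimodal : (ℕ → ℕ) → Set
Unimodal a = ∃[ b ] IsDegree a b × ∃[ t ] (t ≤ b ×
  (∀ i → i < t → a i ≤ a (suc i)) ×
  (∀ i → t ≤ i → i < b → a (suc i) ≤ a i))

LogConcave : (ℕ → ℕ) → Set
LogConcave a = ∃[ b ] IsDegree a b ×
  (∀ j → 1 ≤ j → suc j ≤ b → a (j ∸ 1) * a (suc j) ≤ a j * a j)

{-# OPTIONS --safe #-}

-- Γ(ℤ_{p²}) is the complete graph on the nonzero multiples of p, whose independent dominating sets
-- are the singletons, so D_i = (p-1)x. Γ(ℤ_{2p}) is the star with centre p whose leaves are the p-1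
-- nonzero even residues; its independent dominating sets are {p} and the set of leaves, so
-- D_i = x + x^{p-1}. Only the supports matter: a sequence supported exactly on {i, j} with i ≤ j is
-- log-concave unless j = i + 2 (which would need p = 4), and unimodal iff the support has no gap,
-- j ≤ i + 1 (that is, p = 3).
module Submission where

open import Defs
open import Data.Nat
open import Data.Nat.Properties
open import Data.Nat.Divisibility
open import Data.Nat.Coprimality using (Coprime; coprime-divisor)
open import Data.Nat.Primality
open import Data.List using (List; []; _∷_; [_]; length; applyUpTo)
open import Data.List.Properties using (length-applyUpTo)
open import Data.List.Relation.Unary.All as All using (All; []; _∷_)
open import Data.List.Relation.Unary.Any using (Any; here; there)
open import Data.List.Relation.Unary.AllPairs using (AllPairs; []; _∷_)
import Data.List.Relation.Unary.AllPairs.Properties as AllPairs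
open import Data.List.Membership.Propositional using (_∈_; find; lose)
open import Data.List.Membership.Propositional.Properties
open import Data.List.Membership.DecPropositional _≟_ using (_∈?_)
open import Data.Product using (_×_; _,_; ∃-syntax)
open import Data.Sum using (_⊎_; inj₁; inj₂; [_,_]′)
import Data.Sum as Sum
open import Function using (_∘_)
open import Level using (0ℓ)
open import Function.Bundles using (_⇔_; mk⇔; Equivalence)
open import Function.Properties.Equivalence using () renaming (trans to ⇔-trans)
open import Relation.Binary using (Rel; Reflexive; Transitive)
open import Relation.Nullary using (¬_; yes; no; contradiction)
open import Relation.Nullary.Decidable using (decidable-stable)
open import Relation.Binary.PropositionalEquality
  using (_≡_; _≢_; refl; sym; trans; cong; subst; ≢-sym)

degree-bound : ∀ {a b k} → IsDegree a b → a k ≢ 0 → k ≤ b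
degree-bound (_ , beyond) ak≢0 = ≮⇒≥ (ak≢0 ∘ beyond _)

module _ {_∼_ : Rel ℕ 0ℓ} (refl∼ : Reflexive _∼_) (trans∼ : Transitive _∼_)
         {a : ℕ → ℕ} {l u : ℕ} (step : ∀ i → l ≤ i → i < u → a i ∼ a (suc i)) where

  stepwise : ∀ {i j} → l ≤ i → i ≤ j → j ≤ u → a i ∼ a j
  stepwise {j = zero} _ z≤n _ = refl∼
  stepwise {i} {suc j} l≤i i≤1+j 1+j≤u with m≤n⇒m<n∨m≡n i≤1+j
  ... | inj₂ refl = refl∼
  ... | inj₁ (s≤s i≤j) =
    trans∼ (stepwise l≤i i≤j (≤-trans (n≤1+n j) 1+j≤u)) (step j (≤-trans l≤i i≤j) 1+j≤u)

unimodal⇒noInternalZero : ∀ {a i j k} → Unimodal a → i ≤ j → j ≤ k →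
                          a i ≢ 0 → a k ≢ 0 → a j ≢ 0
unimodal⇒noInternalZero {a} {i} {j} {k} (b , deg , t , _ , up , down) i≤j j≤k ai≢0 ak≢0 aj≡0
  with ≤-total j t
... | inj₁ j≤t = ai≢0 (n≤0⇒n≡0 (subst (a i ≤_) aj≡0
        (stepwise {_∼_ = _≤_} ≤-refl ≤-trans {a = a} (λ i _ → up i) z≤n i≤j j≤t)))
... | inj₂ t≤j = ak≢0 (n≤0⇒n≡0 (subst (a k ≤_) aj≡0
        (stepwise {_∼_ = _≥_} ≤-refl (λ x y → ≤-trans y x) {a = a} down
                  t≤j j≤k (degree-bound deg ak≢0))))

vanishingBelowTopTwo⇒unimodal : ∀ {a b} → IsDegree a b → (∀ k → suc k < b → a k ≡ 0) → Unimodal a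
vanishingBelowTopTwo⇒unimodal {b = zero} deg _ = 0 , deg , 0 , z≤n , (λ _ ()) , λ _ _ ()
vanishingBelowTopTwo⇒unimodal {a} {suc b} deg vanish with ≤-total (a b) (a (suc b))
... | inj₁ rising = suc b , deg , suc b , ≤-refl , up , λ i t≤i i<t → contradiction t≤i (<⇒≱ i<t)
  where
  up : ∀ i → i < suc b → a i ≤ a (suc i)
  up i i<1+b with m≤n⇒m<n∨m≡n (s≤s⁻¹ i<1+b)
  ... | inj₁ i<b rewrite vanish i (s≤s i<b) = z≤n
  ... | inj₂ refl = rising
... | inj₂ falling = suc b , deg , b , n≤1+n b , up , down
  where
  up : ∀ i → i < b → a i ≤ a (suc i)
  up i i<b rewrite vanish i (s≤s i<b) = z≤n
  down : ∀ i → b ≤ i → i < suc b → a (suc i) ≤ a i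
  down i b≤i i<1+b rewrite ≤-antisym (s≤s⁻¹ i<1+b) b≤i = falling

noSupportAtDistance2⇒logConcave : ∀ {a b} → IsDegree a b →
                                  (∀ i → a i ≢ 0 → a (2 + i) ≡ 0) → LogConcave a
noSupportAtDistance2⇒logConcave {a} {b} deg gap =
  b , deg , λ j 1≤j _ → ≤-trans (≤-reflexive (outer-product≡0 j 1≤j)) z≤n
  where
  outer-product≡0 : ∀ j → 1 ≤ j → a (j ∸ 1) * a (suc j) ≡ 0
  outer-product≡0 (suc j) _ with a j ≟ 0
  ... | yes aj≡0 rewrite aj≡0 = refl
  ... | no aj≢0 rewrite gap j aj≢0 = *-zeroʳ (a j)

record SupportIsPair (a : ℕ → ℕ) (i j : ℕ) : Set where
  field
    ai≢0 : a i ≢ 0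
    aj≢0 : a j ≢ 0
    support⊆ : ∀ {k} → a k ≢ 0 → k ≡ i ⊎ k ≡ j

module _ {a : ℕ → ℕ} {i j : ℕ} (i≤j : i ≤ j) (pair : SupportIsPair a i j) where
  open SupportIsPair pair

  outside-pair≡0 : ∀ {k} → k ≢ i → k ≢ j → a k ≡ 0
  outside-pair≡0 k≢i k≢j = decidable-stable (_ ≟ 0) λ ak≢0 → [ k≢i , k≢j ]′ (support⊆ ak≢0)

  pair-degree : IsDegree a j
  pair-degree = aj≢0 , λ k j<k → outside-pair≡0 (>⇒≢ (≤-<-trans i≤j j<k)) (>⇒≢ j<k)

  pair-logConcave : j ≢ 2 + i → LogConcave a
  pair-logConcave j≢2+i = noSupportAtDistance2⇒logConcave pair-degree gap
    where
    gap : ∀ k → a k ≢ 0 → a (2 + k) ≡ 0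
    gap k ak≢0 with support⊆ ak≢0
    ... | inj₁ refl = outside-pair≡0 (>⇒≢ (m<n+m k z<s)) (j≢2+i ∘ sym)
    ... | inj₂ refl = outside-pair≡0 (>⇒≢ (≤-<-trans i≤j (m<n+m k z<s))) (>⇒≢ (m<n+m k z<s))

  pair-unimodal⇔ : Unimodal a ⇔ j ≤ suc i
  pair-unimodal⇔ = mk⇔ adjacent unimodal
    where
    adjacent : Unimodal a → j ≤ suc i
    adjacent uni = decidable-stable (j ≤? suc i) λ j≰1+i →
      unimodal⇒noInternalZero uni (n≤1+n i) (<⇒≤ (≰⇒> j≰1+i)) ai≢0 aj≢0
        (outside-pair≡0 (>⇒≢ ≤-refl) (<⇒≢ (≰⇒> j≰1+i)))
    unimodal : j ≤ suc i → Unimodal a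
    unimodal j≤1+i = vanishingBelowTopTwo⇒unimodal pair-degree λ k 1+k<j →
      outside-pair≡0 (<⇒≢ (s≤s⁻¹ (≤-trans 1+k<j j≤1+i))) (<⇒≢ (<-trans (n<1+n k) 1+k<j))

-- Vertex sets are increasing lists: IsIDSofSize accepts lists with repetitions, such as c ∷ c ∷ [],
-- whose length is not the size of the set.
Increasing : List ℕ → Set
Increasing = AllPairs _<_

⊆-∷⁻ : ∀ {x ys zs} → All (x <_) ys → All (_∈ x ∷ zs) ys → All (_∈ zs) ys
⊆-∷⁻ [] [] = []
⊆-∷⁻ (x<y ∷ x<ys) (here refl ∷ _) = contradiction x<y (<-irrefl refl)
⊆-∷⁻ (_ ∷ x<ys) (there y∈zs ∷ ys⊆) = y∈zs ∷ ⊆-∷⁻ x<ys ys⊆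

least-elements-≡ : ∀ {x y xs ys} → All (x <_) xs → All (y <_) ys →
                   x ∈ y ∷ ys → y ∈ x ∷ xs → x ≡ y
least-elements-≡ _ _ (here x≡y) _ = x≡y
least-elements-≡ _ _ (there _) (here y≡x) = sym y≡x
least-elements-≡ x<xs y<ys (there x∈ys) (there y∈xs) =
  contradiction (All.lookup y<ys x∈ys) (<-asym (All.lookup x<xs y∈xs))

increasing-antisym : ∀ {xs ys} → Increasing xs → Increasing ys →
                     All (_∈ ys) xs → All (_∈ xs) ys → xs ≡ ys
increasing-antisym {[]} {[]} _ _ _ _ = refl
increasing-antisym {[]} {_ ∷ _} _ _ _ (() ∷ _)
increasing-antisym {_ ∷ _} {[]} _ _ (() ∷ _) _
increasing-antisym (x<xs ∷ xs↑) (y<ys ∷ ys↑) (x∈ ∷ xs⊆) (y∈ ∷ ys⊆)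
  with refl ← least-elements-≡ x<xs y<ys x∈ y∈ =
  cong (_ ∷_) (increasing-antisym xs↑ ys↑ (⊆-∷⁻ x<xs xs⊆) (⊆-∷⁻ y<ys ys⊆))

∈-sublists⁻ : ∀ {V S} → Increasing V → S ∈ sublists V → Increasing S × All (_∈ V) S
∈-sublists⁻ {[]} [] (here refl) = [] , []
∈-sublists⁻ {x ∷ V} (x<V ∷ V↑) S∈ with ∈-++⁻ _ S∈
... | inj₂ S∈V = let S↑ , S⊆V = ∈-sublists⁻ V↑ S∈V in S↑ , All.map there S⊆V
... | inj₁ xS∈ with S , S∈V , refl ← ∈-map⁻ (x ∷_) xS∈ =
  let S↑ , S⊆V = ∈-sublists⁻ V↑ S∈V
  in All.map (All.lookup x<V) S⊆V ∷ S↑ , here refl ∷ All.map there S⊆V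

[]∈sublists : ∀ (V : List ℕ) → [] ∈ sublists V
[]∈sublists [] = here refl
[]∈sublists (x ∷ V) = ∈-++⁺ʳ _ ([]∈sublists V)

∈-sublists⁺ : ∀ {V S} → Increasing V → Increasing S → All (_∈ V) S → S ∈ sublists V
∈-sublists⁺ {V} {[]} _ _ _ = []∈sublists V
∈-sublists⁺ {x ∷ V} {s ∷ S} (_ ∷ V↑) (s<S ∷ S↑) (here refl ∷ S⊆) =
  ∈-++⁺ˡ (∈-map⁺ (x ∷_) (∈-sublists⁺ V↑ S↑ (⊆-∷⁻ s<S S⊆)))
∈-sublists⁺ {x ∷ V} {s ∷ S} (x<V ∷ V↑) (s<S ∷ S↑) (there s∈V ∷ S⊆) =
  ∈-++⁺ʳ _ (∈-sublists⁺ V↑ (s<S ∷ S↑) (⊆-∷⁻ (x<s ∷ All.map (<-trans x<s) s<S) (there s∈V ∷ S⊆)))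
  where
  x<s : x < s
  x<s = All.lookup x<V s∈V

vertices-increasing : ∀ n → Increasing (vertices n)
vertices-increasing n =
  AllPairs.filter⁺ (isZeroDivisor? n) (AllPairs.applyUpTo⁺₁ _ n (λ i<j _ → i<j))

∈-vertices⁻ : ∀ {n v} → v ∈ vertices n → 0 < v × v < n × ∃[ b ] (0 < b × b < n × n ∣ v * b)
∈-vertices⁻ v∈V with v∈ , 0<v , witness ← ∈-filter⁻ (isZeroDivisor? _) v∈V
                 with b , b∈ , 0<b , n∣vb ← find witness =
  0<v , ∈-upTo⁻ v∈ , b , 0<b , ∈-upTo⁻ b∈ , n∣vb

∈-vertices⁺ : ∀ {n v} b → 0 < v → v < n → 0 < b → b < n → n ∣ v * b → v ∈ vertices n
∈-vertices⁺ b 0<v v<n 0<b b<n n∣vb =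
  ∈-filter⁺ (isZeroDivisor? _) (∈-upTo⁺ v<n) (0<v , lose (∈-upTo⁺ b<n) (0<b , n∣vb))

length≢0⇒∈ : ∀ {A : Set} {xs : List A} → length xs ≢ 0 → ∃[ x ] x ∈ xs
length≢0⇒∈ {xs = []} 0≢0 = contradiction refl 0≢0
length≢0⇒∈ {xs = x ∷ _} _ = x , here refl

∈⇒length≢0 : ∀ {A : Set} {x : A} {xs} → x ∈ xs → length xs ≢ 0
∈⇒length≢0 (here _) ()
∈⇒length≢0 (there _) ()

idCoeff≢0⇒ids : ∀ {n k} → idCoeff n k ≢ 0 →
                ∃[ S ] Increasing S × All (_∈ vertices n) S × IsIDSofSize n k S
idCoeff≢0⇒ids {n} {k} ≢0
  with S , S∈ ← length≢0⇒∈ ≢0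
  with S∈sublists , ids ← ∈-filter⁻ (isIDSofSize? n k) S∈ =
  let S↑ , S⊆V = ∈-sublists⁻ (vertices-increasing n) S∈sublists in S , S↑ , S⊆V , ids

ids⇒idCoeff≢0 : ∀ {n k S} → Increasing S → All (_∈ vertices n) S → IsIDSofSize n k S →
                idCoeff n k ≢ 0
ids⇒idCoeff≢0 {n} {k} S↑ S⊆V ids =
  ∈⇒length≢0 (∈-filter⁺ (isIDSofSize? n k) (∈-sublists⁺ (vertices-increasing n) S↑ S⊆V) ids)

adj-sym : ∀ {n a b} → Adj n a b → Adj n b a
adj-sym {n} {a} {b} (a≢b , n∣ab) = ≢-sym a≢b , subst (n ∣_) (*-comm a b) n∣ab

independent⇒≁ : ∀ {n S x y} → Independent n S → x ∈ S → y ∈ S → ¬ Adj n x y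
independent⇒≁ _ (here refl) (here refl) (x≢x , _) = x≢x refl
independent⇒≁ (x≁S ∷ _) (here refl) (there y∈S) = All.lookup x≁S y∈S
independent⇒≁ (y≁S ∷ _) (there x∈S) (here refl) = All.lookup y≁S x∈S ∘ adj-sym
independent⇒≁ (_ ∷ S-ind) (there x∈S) (there y∈S) = independent⇒≁ S-ind x∈S y∈S

module Complete {n c : ℕ} (c∈V : c ∈ vertices n)
                (complete : ∀ {x y} → x ∈ vertices n → y ∈ vertices n → x ≢ y → Adj n x y) where

  singleton-ids : IsIDSofSize n 1 [ c ]
  singleton-ids = refl , [] ∷ [] , All.tabulate dominated
    where
    dominated : ∀ {v} → v ∈ vertices n → v ∈ [ c ] ⊎ Any (Adj n v) [ c ]
    dominated {v} v∈V with v ≟ c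
    ... | yes v≡c = inj₁ (here v≡c)
    ... | no v≢c = inj₂ (here (complete v∈V c∈V v≢c))

  ids-size≡1 : ∀ {k S} → Increasing S → All (_∈ vertices n) S → IsIDSofSize n k S → k ≡ 1
  ids-size≡1 {S = []} _ _ (_ , _ , dominating) with All.lookup dominating c∈V
  ... | inj₁ ()
  ... | inj₂ ()
  ids-size≡1 {S = _ ∷ []} _ _ (refl , _) = refl
  ids-size≡1 {S = _ ∷ _ ∷ _} ((x<y ∷ _) ∷ _) (x∈V ∷ y∈V ∷ _) (_ , (x≁y ∷ _) ∷ _ , _) =
    contradiction (complete x∈V y∈V (<⇒≢ x<y)) x≁y

  support : SupportIsPair (idCoeff n) 1 1
  support = record { ai≢0 = 1≢0 ; aj≢0 = 1≢0 ; support⊆ = sizes }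
    where
    sizes : ∀ {k} → idCoeff n k ≢ 0 → k ≡ 1 ⊎ k ≡ 1
    sizes ak≢0 = let _ , S↑ , S⊆V , ids = idCoeff≢0⇒ids ak≢0 in inj₁ (ids-size≡1 S↑ S⊆V ids)
    1≢0 : idCoeff n 1 ≢ 0
    1≢0 = ids⇒idCoeff≢0 ([] ∷ []) (c∈V ∷ []) singleton-ids

record IsStar (n c : ℕ) (L : List ℕ) : Set where
  field
    leaves-increasing : Increasing L
    some-leaf : ∃[ ℓ ] ℓ ∈ L
    center∈V : c ∈ vertices n
    leaves⊆V : All (_∈ vertices n) L
    leaf-or-center : ∀ {v} → v ∈ vertices n → v ∈ L ⊎ v ≡ c
    leaf-adj-center : ∀ {v} → v ∈ L → Adj n v c
    leaves-independent : Independent n L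

module Star {n c : ℕ} {L : List ℕ} (star : IsStar n c L) where
  open IsStar star

  center-ids : IsIDSofSize n 1 [ c ]
  center-ids = refl , [] ∷ [] , All.tabulate dominated
    where
    dominated : ∀ {v} → v ∈ vertices n → v ∈ [ c ] ⊎ Any (Adj n v) [ c ]
    dominated v∈V with leaf-or-center v∈V
    ... | inj₁ v∈L = inj₂ (here (leaf-adj-center v∈L))
    ... | inj₂ v≡c = inj₁ (here v≡c)

  leaves-ids : IsIDSofSize n (length L) L
  leaves-ids = refl , leaves-independent , All.tabulate dominated
    where
    dominated : ∀ {v} → v ∈ vertices n → v ∈ L ⊎ Any (Adj n v) L
    dominated v∈V with leaf-or-center v∈V
    ... | inj₁ v∈L = inj₁ v∈L
    ... | inj₂ refl = let ℓ , ℓ∈L = some-leaf in inj₂ (lose ℓ∈L (adj-sym (leaf-adj-center ℓ∈L)))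

  ids-is-center-or-leaves : ∀ {k S} → Increasing S → All (_∈ vertices n) S → IsIDSofSize n k S →
                            S ≡ [ c ] ⊎ S ≡ L
  ids-is-center-or-leaves {S = S} S↑ S⊆V (_ , independent , dominating) with c ∈? S
  ... | yes c∈S =
    inj₁ (increasing-antisym S↑ ([] ∷ []) (All.tabulate (here ∘ only-center)) (c∈S ∷ []))
    where
    only-center : ∀ {s} → s ∈ S → s ≡ c
    only-center s∈S with leaf-or-center (All.lookup S⊆V s∈S)
    ... | inj₁ s∈L = contradiction (leaf-adj-center s∈L) (independent⇒≁ independent s∈S c∈S)
    ... | inj₂ s≡c = s≡c
  ... | no c∉S =
    inj₂ (increasing-antisym S↑ leaves-increasing (All.tabulate S⊆L) (All.tabulate L⊆S))
    where
    S⊆L : ∀ {s} → s ∈ S → s ∈ L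
    S⊆L s∈S with leaf-or-center (All.lookup S⊆V s∈S)
    ... | inj₁ s∈L = s∈L
    ... | inj₂ refl = contradiction s∈S c∉S
    L⊆S : ∀ {ℓ} → ℓ ∈ L → ℓ ∈ S
    L⊆S ℓ∈L with All.lookup dominating (All.lookup leaves⊆V ℓ∈L)
    ... | inj₁ ℓ∈S = ℓ∈S
    ... | inj₂ ℓ∼S with s , s∈S , ℓ∼s ← find ℓ∼S =
      contradiction ℓ∼s (independent⇒≁ leaves-independent ℓ∈L (S⊆L s∈S))

  support : SupportIsPair (idCoeff n) 1 (length L)
  support = record
    { ai≢0 = ids⇒idCoeff≢0 ([] ∷ []) (center∈V ∷ []) center-ids
    ; aj≢0 = ids⇒idCoeff≢0 leaves-increasing leaves⊆V leaves-ids
    ; support⊆ = sizes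
    }
    where
    sizes : ∀ {k} → idCoeff n k ≢ 0 → k ≡ 1 ⊎ k ≡ length L
    sizes ak≢0 with S , S↑ , S⊆V , ids@(|S|≡k , _) ← idCoeff≢0⇒ids ak≢0
                 with ids-is-center-or-leaves S↑ S⊆V ids
    ... | inj₁ refl = inj₁ (sym |S|≡k)
    ... | inj₂ refl = inj₂ (sym |S|≡k)

prime∤⇒coprime : ∀ {p n} → Prime p → ¬ p ∣ n → Coprime p n
prime∤⇒coprime p-prime p∤n (d∣p , d∣n) with prime⇒irreducible p-prime d∣p
... | inj₁ d≡1 = d≡1
... | inj₂ refl = contradiction d∣n p∤n

coprime⇒*∣ : ∀ {m n x} → Coprime m n → m ∣ x → n ∣ x → m * n ∣ x
coprime⇒*∣ {m} {n} m⊥n m∣x (divides q refl) =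
  *-monoˡ-∣ n (coprime-divisor m⊥n (subst (m ∣_) (*-comm q n) m∣x))

prime-square-divisor : ∀ {p n o} → Prime p → ¬ p ∣ n → p * p ∣ n * o → p * p ∣ o
prime-square-divisor {p} {n} p-prime p∤n p²∣no =
  p²∣o p²∣no (coprime-divisor p⊥n (∣-trans (m∣m*n p) p²∣no))
  where
  p⊥n : Coprime p n
  p⊥n = prime∤⇒coprime p-prime p∤n
  p²∣o : ∀ {o} → p * p ∣ n * o → p ∣ o → p * p ∣ o
  p²∣o p²∣nqp (divides q refl) = *-monoˡ-∣ p (coprime-divisor p⊥n
    (*-cancelʳ-∣ p {{prime⇒nonZero p-prime}} (subst (p * p ∣_) (sym (*-assoc n q p)) p²∣nqp)))

multiple-below-double⇒≡ : ∀ {n v} → n ∣ v → 0 < v → v < 2 * n → v ≡ n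
multiple-below-double⇒≡ (divides zero refl) ()
multiple-below-double⇒≡ {n} (divides (suc zero) refl) _ _ = +-identityʳ n
multiple-below-double⇒≡ {n} (divides (suc (suc _)) refl) _ v<2n =
  contradiction v<2n (≤⇒≯ (+-monoʳ-≤ n (+-monoʳ-≤ n z≤n)))

module PrimeSquare {p : ℕ} (p-prime : Prime p) where
  private instance
    p≢0 : NonZero p
    p≢0 = prime⇒nonZero p-prime

  p∣vertex : ∀ {v} → v ∈ vertices (p * p) → p ∣ v
  p∣vertex {v} v∈V with p ∣? v
  ... | yes p∣v = p∣v
  ... | no p∤v with _ , _ , b , 0<b , b<p² , p²∣vb ← ∈-vertices⁻ v∈V =
    contradiction (prime-square-divisor p-prime p∤v p²∣vb) (>⇒∤ {{>-nonZero 0<b}} b<p²)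

  p∈V : p ∈ vertices (p * p)
  p∈V = ∈-vertices⁺ p (>-nonZero⁻¹ p) p<p² (>-nonZero⁻¹ p) p<p² ∣-refl
    where
    p<p² : p < p * p
    p<p² = m<m*n p p (nonTrivial⇒n>1 p {{prime⇒nonTrivial p-prime}})

  support : SupportIsPair (idCoeff (p * p)) 1 1
  support = Complete.support p∈V λ x∈V y∈V x≢y →
    x≢y , *-pres-∣ (p∣vertex x∈V) (p∣vertex y∈V)

  unimodal×logConcave : Unimodal (idCoeff (p * p)) × LogConcave (idCoeff (p * p))
  unimodal×logConcave =
    Equivalence.from (pair-unimodal⇔ ≤-refl support) (n≤1+n 1) ,
    pair-logConcave ≤-refl support (λ ())

module TwiceOddPrime {p : ℕ} (p-prime : Prime p) (2<p : 2 < p) where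
  private instance
    p≢0 : NonZero p
    p≢0 = prime⇒nonZero p-prime

  p-odd : ¬ 2 ∣ p
  p-odd 2∣p with prime⇒irreducible p-prime 2∣p
  ... | inj₂ 2≡p = <-irrefl 2≡p 2<p

  p<2p : p < 2 * p
  p<2p = subst (p <_) (*-comm p 2) (m<m*n p 2 ≤-refl)

  Even : ℕ → Set
  Even x = 2 ∣ x × 0 < x × x < 2 * p

  even⇒p∤ : ∀ {x} → Even x → ¬ p ∣ x
  even⇒p∤ (2∣x , 0<x , x<2p) p∣x =
    >⇒∤ {{>-nonZero 0<x}} x<2p (coprime⇒*∣ (prime∤⇒coprime prime[2] p-odd) 2∣x p∣x)

  -- An odd vertex v forces its annihilator b to be even, so p ∤ b (else 2p ∣ b) and p ∣ v.
  even-or-p : ∀ {v} → v ∈ vertices (2 * p) → Even v ⊎ v ≡ p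
  even-or-p {v} v∈V with 0<v , v<2p , b , 0<b , b<2p , 2p∣vb ← ∈-vertices⁻ v∈V with 2 ∣? v
  ... | yes 2∣v = inj₁ (2∣v , 0<v , v<2p)
  ... | no 2∤v with euclidsLemma v b p-prime (∣-trans (n∣m*n 2) 2p∣vb)
  ...   | inj₁ p∣v = inj₂ (multiple-below-double⇒≡ p∣v 0<v v<2p)
  ...   | inj₂ p∣b = contradiction p∣b (even⇒p∤ (2∣b , 0<b , b<2p))
    where
    2∣b : 2 ∣ b
    2∣b = coprime-divisor (prime∤⇒coprime prime[2] 2∤v) (∣-trans (m∣m*n p) 2p∣vb)

  evens : List ℕ
  evens = applyUpTo (λ i → suc i * 2) (pred p)

  even-at : ∀ {i} → i < pred p → Even (suc i * 2)
  even-at {i} i<p-1 =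
    n∣m*n (suc i) , z<s , subst (suc i * 2 <_) (*-comm p 2) (*-monoˡ-< 2 (m≤pred[n]⇒suc[m]≤n i<p-1))

  ∈-evens⁻ : ∀ {x} → x ∈ evens → Even x
  ∈-evens⁻ x∈ with _ , i<p-1 , refl ← ∈-applyUpTo⁻ _ x∈ = even-at i<p-1

  ∈-evens⁺ : ∀ {x} → Even x → x ∈ evens
  ∈-evens⁺ (divides zero refl , () , _)
  ∈-evens⁺ (divides (suc i) refl , _ , x<2p) =
    ∈-applyUpTo⁺ _ (suc[m]≤n⇒m≤pred[n]
      (*-cancelʳ-< 2 (suc i) p (subst (suc i * 2 <_) (*-comm 2 p) x<2p)))

  evens-nonadjacent : ∀ {x y} → Even x → Even y → ¬ Adj (2 * p) x y
  evens-nonadjacent {x} {y} even-x even-y (_ , 2p∣xy)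
    with euclidsLemma x y p-prime (∣-trans (n∣m*n 2) 2p∣xy)
  ... | inj₁ p∣x = even⇒p∤ even-x p∣x
  ... | inj₂ p∣y = even⇒p∤ even-y p∣y

  even-adj-p : ∀ {x} → Even x → Adj (2 * p) x p
  even-adj-p (2∣x , _) = (λ x≡p → p-odd (subst (2 ∣_) x≡p 2∣x)) , *-monoˡ-∣ p 2∣x

  star : IsStar (2 * p) p evens
  star = record
    { leaves-increasing = AllPairs.applyUpTo⁺₁ _ _ (λ i<j _ → *-monoˡ-< 2 (s<s i<j))
    ; some-leaf = 2 , ∈-evens⁺ (∣-refl , z<s , 2<2p)
    ; center∈V = ∈-vertices⁺ 2 (>-nonZero⁻¹ p) p<2p z<s 2<2p (∣-reflexive (*-comm 2 p))
    ; leaves⊆V = All.tabulate (even∈V ∘ ∈-evens⁻)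
    ; leaf-or-center = Sum.map₁ ∈-evens⁺ ∘ even-or-p
    ; leaf-adj-center = even-adj-p ∘ ∈-evens⁻
    ; leaves-independent = AllPairs.applyUpTo⁺₁ _ _ λ i<j j<p-1 →
        evens-nonadjacent (even-at (<-trans i<j j<p-1)) (even-at j<p-1)
    }
    where
    2<2p : 2 < 2 * p
    2<2p = <-trans 2<p p<2p
    even∈V : ∀ {x} → Even x → x ∈ vertices (2 * p)
    even∈V (2∣x , 0<x , x<2p) = ∈-vertices⁺ p 0<x x<2p (>-nonZero⁻¹ p) p<2p (*-monoˡ-∣ p 2∣x)

  support : SupportIsPair (idCoeff (2 * p)) 1 (pred p)
  support =
    subst (SupportIsPair (idCoeff (2 * p)) 1) (length-applyUpTo _ (pred p)) (Star.support star)

  1≤p-1 : 1 ≤ pred p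
  1≤p-1 = suc[m]≤n⇒m≤pred[n] (<⇒≤ 2<p)

  logConcave : LogConcave (idCoeff (2 * p))
  logConcave = pair-logConcave 1≤p-1 support p-1≢3
    where
    p-1≢3 : pred p ≢ 3
    p-1≢3 p-1≡3 =
      composite⇒¬prime composite[4]
        (subst Prime (trans (sym (suc-pred p)) (cong suc p-1≡3)) p-prime)

  unimodal⇔p≡3 : Unimodal (idCoeff (2 * p)) ⇔ (p ≡ 3)
  unimodal⇔p≡3 = ⇔-trans (pair-unimodal⇔ 1≤p-1 support) (mk⇔ p-1≤2⇒p≡3 (≤-reflexive ∘ cong pred))
    where
    p-1≤2⇒p≡3 : pred p ≤ 2 → p ≡ 3
    p-1≤2⇒p≡3 p-1≤2 = ≤-antisym (subst (_≤ 3) (suc-pred p) (s≤s p-1≤2)) 2<p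

proposition1 :
    ((p : ℕ) → Prime p → Unimodal (idCoeff (p ^ 2)) × LogConcave (idCoeff (p ^ 2)))
    × ((p : ℕ) → Prime p → 2 < p →
        LogConcave (idCoeff (2 * p)) × (Unimodal (idCoeff (2 * p)) ⇔ (p ≡ 3)))
proposition1 =
  (λ p p-prime → subst (λ n → Unimodal (idCoeff n) × LogConcave (idCoeff n))
                       (cong (p *_) (sym (*-identityʳ p)))
                       (PrimeSquare.unimodal×logConcave p-prime)) ,
  (λ p p-prime 2<p → TwiceOddPrime.logConcave p-prime 2<p , TwiceOddPrime.unimodal⇔p≡3 p-prime 2<p)
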